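{- If $\mathbb{A}=(L,\wedge,\vee,{}',\top,\bot)$ is a semi De Morgan algebra, then its kernel $\mathbb{K}_{\mathbb{A}}=(K,\cap,\cup,{}^*,1,0)$ is a De Morgan algebra.
   Context: A semi De Morgan algebra (SMA) is an algebra $(L,\wedge,\vee,{}',\top,\bot)$ such that $(L,\wedge,\vee,\top,\bot)$ is a bounded distributive lattice and for all $a,b\in L$: $\bot'=\top$, $\top'=\bot$, $(a\vee b)'=a'\wedge b'$, $(a\wedge b)''=a''\wedge b''$, $a'=a'''$. For an SMA, let $K=\{a'':a\in L\}$, $h:L\to K$ given by $h(a)=a''$, and $e:K\to L$ the inclusion. The kernel $\mathbb{K}_{\mathbb{A}}=(K,\cap,\cup,{}^*,1,0)$ is defined by $\alpha\cup\beta=h((e(\alpha)\vee e(\beta))'')$, $\alpha\cap\beta=h(e(\alpha)\wedge e(\beta))$, $1=h(\top)$, $0=h(\bot)$, $\alpha^*=h(e(\alpha)')$. A De Morgan algebra is an algebra $(D,\cap,\cup,{}^*,1,0)$ where $(D,\cap,\cup,1,0)$ is a bounded distributive lattice and $0^*=1$, $1^*=0$, $(a\cup b)^*=a^*\cap b^*$, $(a\cap b)^*=a^*\cup b^*$, $a^{**}=a$ for all $a,b$. -}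

module Defs where

open import Level using (Level; suc; _⊔_)
open import Data.Product using (Σ; ∃; _,_; proj₁)
open import Relation.Binary.Core using (Rel)
open import Relation.Binary.PropositionalEquality using (_≡_; refl)
open import Algebra.Core using (Op₁; Op₂)
import Algebra.Definitions as AD
open import Algebra.Lattice.Structures using (IsDistributiveLattice)

record IsBoundedDistributiveLattice {a ℓ} {A : Set a} (_≈_ : Rel A ℓ)
         (∨ ∧ : Op₂ A) (⊤ ⊥ : A) : Set (a ⊔ ℓ) where
  open AD _≈_
  field
    isDistributiveLattice : IsDistributiveLattice _≈_ ∨ ∧
    ∧-identity            : Identity ⊤ ∧
    ∨-identity            : Identity ⊥ ∨

record IsDeMorganAlgebra {a ℓ} {D : Set a} (_≈_ : Rel D ℓ)
         (_∩_ _∪_ : Op₂ D) (_* : Op₁ D) (𝟙 𝟘 : D) : Set (a ⊔ ℓ) where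
  field
    isBoundedDistributiveLattice : IsBoundedDistributiveLattice _≈_ _∪_ _∩_ 𝟙 𝟘
    *-cong    : ∀ {x y} → x ≈ y → (x *) ≈ (y *)
    𝟘*≈𝟙      : (𝟘 *) ≈ 𝟙
    𝟙*≈𝟘      : (𝟙 *) ≈ 𝟘
    ∪-deMorgan : ∀ x y → ((x ∪ y) *) ≈ ((x *) ∩ (y *))
    ∩-deMorgan : ∀ x y → ((x ∩ y) *) ≈ ((x *) ∪ (y *))
    involutive : ∀ x → ((x *) *) ≈ x

record SemiDeMorganAlgebra (a : Level) : Set (suc a) where
  infixr 7 _∧_
  infixr 6 _∨_
  infix  8 _′
  field
    Carrier : Set a
    _∧_ _∨_ : Op₂ Carrier
    _′      : Op₁ Carrier
    ⊤ ⊥     : Carrier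
    isBoundedDistributiveLattice :
      IsBoundedDistributiveLattice _≡_ _∨_ _∧_ ⊤ ⊥
    ⊥′≡⊤   : ⊥ ′ ≡ ⊤
    ⊤′≡⊥   : ⊤ ′ ≡ ⊥
    ∨-′    : ∀ x y → (x ∨ y) ′ ≡ x ′ ∧ y ′
    ∧-′′   : ∀ x y → (x ∧ y) ′ ′ ≡ x ′ ′ ∧ y ′ ′
    ′′′    : ∀ x → x ′ ≡ x ′ ′ ′

module Kernel {a : Level} (𝔸 : SemiDeMorganAlgebra a) where
  open SemiDeMorganAlgebra 𝔸

  K : Set a
  K = Σ Carrier (λ x → ∃ λ y → x ≡ y ′ ′)

  _≈K_ : Rel K a
  α ≈K β = proj₁ α ≡ proj₁ β

  h : Carrier → K
  h x = (x ′ ′ , x , refl)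

  e : K → Carrier
  e = proj₁

  _∪_ : Op₂ K
  α ∪ β = h ((e α ∨ e β) ′ ′)

  _∩_ : Op₂ K
  α ∩ β = h (e α ∧ e β)

  𝟙 : K
  𝟙 = h ⊤

  𝟘 : K
  𝟘 = h ⊥

  _* : Op₁ K
  α * = h (e α ′)

module Submission where

-- The kernel K = { x′′ : x ∈ L } of a semi De Morgan algebra L is the
-- homomorphic image of L under the closure c x = x′′.  We make this precise
-- through the kernel relation  x ~ y :⇔ c x ≡ c y  on L:
--   * c is idempotent, and ~ is a congruence for ∧, ∨ and ′;
--   * each element α of K is a fixed point of c, and every operation of K
--     computes, up to ~, the corresponding operation of L on representatives.
-- Hence (via a small language of terms over ∧, ∨, ′, ⊤, ⊥) an identity
-- between terms holds in K as soon as it holds modulo ~ in L.  The lattice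
-- laws of K then come from those of L (which hold even with ≡), and the
-- De Morgan laws reduce to identities modulo ~ that follow directly from the
-- semi De Morgan axioms, e.g. (x ∧ y)′ ~ x′ ∨ y′ and x′′ ~ x.

open import Defs
open import Level using (Level)
open import Data.Nat using (ℕ; suc)
open import Data.Fin using (Fin; zero; suc)
open import Data.Vec.Functional using (Vector; []; _∷_)
open import Data.Product using (_,_; proj₁; proj₂)
open import Function using (_∘_)
open import Algebra.Core using (Op₁; Op₂)
open import Relation.Binary.PropositionalEquality
open import Algebra.Lattice.Structures using (IsDistributiveLattice; IsLattice)

data Term (n : ℕ) : Set where
  var       : Fin n → Term n
  _∨ᵗ_ _∧ᵗ_ : Term n → Term n → Term n
  _′ᵗ       : Term n → Term n
  ⊤ᵗ ⊥ᵗ     : Term n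

infixr 6 _∨ᵗ_
infixr 7 _∧ᵗ_
infix  8 _′ᵗ

v₀ : ∀ {n} → Term (suc n)
v₀ = var zero

v₁ : ∀ {n} → Term (suc (suc n))
v₁ = var (suc zero)

v₂ : ∀ {n} → Term (suc (suc (suc n)))
v₂ = var (suc (suc zero))

eval : ∀ {a} {A : Set a} (∨ ∧ : Op₂ A) (′ : Op₁ A) (⊤ ⊥ : A) →
       ∀ {n} → Term n → Vector A n → A
eval ∨ ∧ ′ ⊤ ⊥ (var i)  ρ = ρ i
eval ∨ ∧ ′ ⊤ ⊥ (t ∨ᵗ u) ρ = ∨ (eval ∨ ∧ ′ ⊤ ⊥ t ρ) (eval ∨ ∧ ′ ⊤ ⊥ u ρ)
eval ∨ ∧ ′ ⊤ ⊥ (t ∧ᵗ u) ρ = ∧ (eval ∨ ∧ ′ ⊤ ⊥ t ρ) (eval ∨ ∧ ′ ⊤ ⊥ u ρ)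
eval ∨ ∧ ′ ⊤ ⊥ (t ′ᵗ)   ρ = ′ (eval ∨ ∧ ′ ⊤ ⊥ t ρ)
eval ∨ ∧ ′ ⊤ ⊥ ⊤ᵗ       ρ = ⊤
eval ∨ ∧ ′ ⊤ ⊥ ⊥ᵗ       ρ = ⊥

module KernelIsDeMorgan {a : Level} (𝔸 : SemiDeMorganAlgebra a) where
  open SemiDeMorganAlgebra 𝔸
  open Kernel 𝔸
  module BD = IsBoundedDistributiveLattice isBoundedDistributiveLattice
  module DL = IsDistributiveLattice BD.isDistributiveLattice
  open ≡-Reasoning

  c : Carrier → Carrier
  c x = x ′ ′

  infix 4 _~_
  _~_ : Carrier → Carrier → Set a
  x ~ y = c x ≡ c y

  c-′ : ∀ x → c x ′ ≡ x ′
  c-′ x = sym (′′′ x)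

  c-~ : ∀ x → c x ~ x
  c-~ x = cong _′ (c-′ x)

  c-fixes-K : ∀ (α : K) → c (e α) ≡ e α
  c-fixes-K (_ , y , refl) = c-~ y

  ′-resp-~ : ∀ {x y} → x ~ y → x ′ ≡ y ′
  ′-resp-~ {x} {y} p = begin
    x ′   ≡⟨ sym (c-′ x) ⟩
    c x ′ ≡⟨ cong _′ p ⟩
    c y ′ ≡⟨ c-′ y ⟩
    y ′   ∎

  ∧-resp-~ : ∀ {x₁ x₂ y₁ y₂} → x₁ ~ x₂ → y₁ ~ y₂ → x₁ ∧ y₁ ~ x₂ ∧ y₂
  ∧-resp-~ {x₁} {x₂} {y₁} {y₂} p q = begin
    c (x₁ ∧ y₁)    ≡⟨ ∧-′′ x₁ y₁ ⟩
    c x₁ ∧ c y₁    ≡⟨ cong₂ _∧_ p q ⟩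
    c x₂ ∧ c y₂    ≡⟨ sym (∧-′′ x₂ y₂) ⟩
    c (x₂ ∧ y₂)    ∎

  ∨-resp-~ : ∀ {x₁ x₂ y₁ y₂} → x₁ ~ x₂ → y₁ ~ y₂ → x₁ ∨ y₁ ~ x₂ ∨ y₂
  ∨-resp-~ {x₁} {x₂} {y₁} {y₂} p q = begin
    c (x₁ ∨ y₁)        ≡⟨ cong _′ (∨-′ x₁ y₁) ⟩
    (x₁ ′ ∧ y₁ ′) ′    ≡⟨ cong _′ (cong₂ _∧_ (′-resp-~ p) (′-resp-~ q)) ⟩
    (x₂ ′ ∧ y₂ ′) ′    ≡⟨ cong _′ (sym (∨-′ x₂ y₂)) ⟩
    c (x₂ ∨ y₂)        ∎

  ~-′ : ∀ {x y} → x ~ y → x ′ ~ y ′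
  ~-′ p = cong c (′-resp-~ p)

  represent : ∀ {n} (t : Term n) (ρ : Vector K n) →
              e (eval _∪_ _∩_ _* 𝟙 𝟘 t ρ) ~ eval _∨_ _∧_ _′ ⊤ ⊥ t (e ∘ ρ)
  represent (var i)  ρ = refl
  represent (t ∨ᵗ u) ρ =
    trans (c-~ _) (trans (c-~ _) (∨-resp-~ (represent t ρ) (represent u ρ)))
  represent (t ∧ᵗ u) ρ = trans (c-~ _) (∧-resp-~ (represent t ρ) (represent u ρ))
  represent (t ′ᵗ)   ρ = trans (c-~ _) (~-′ (represent t ρ))
  represent ⊤ᵗ       ρ = c-~ ⊤
  represent ⊥ᵗ       ρ = c-~ ⊥

  transfer : ∀ {n} (t u : Term n) (ρ : Vector K n) →
             eval _∨_ _∧_ _′ ⊤ ⊥ t (e ∘ ρ) ~ eval _∨_ _∧_ _′ ⊤ ⊥ u (e ∘ ρ) →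
             eval _∪_ _∩_ _* 𝟙 𝟘 t ρ ≈K eval _∪_ _∩_ _* 𝟙 𝟘 u ρ
  transfer t u ρ p = begin
    e T      ≡⟨ sym (c-fixes-K T) ⟩
    c (e T)  ≡⟨ trans (represent t ρ) (trans p (sym (represent u ρ))) ⟩
    c (e U)  ≡⟨ c-fixes-K U ⟩
    e U      ∎
    where T = eval _∪_ _∩_ _* 𝟙 𝟘 t ρ
          U = eval _∪_ _∩_ _* 𝟙 𝟘 u ρ

  ≡⇒~ : ∀ {x y} → x ≡ y → x ~ y
  ≡⇒~ = cong c

  -- (x ∧ y)′ ~ x′ ∨ y′: both sides close to (x ∧ y)′.
  ∧-′-~ : ∀ x y → (x ∧ y) ′ ~ x ′ ∨ y ′
  ∧-′-~ x y = begin
    c ((x ∧ y) ′)        ≡⟨ sym (′′′ (x ∧ y)) ⟩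
    (x ∧ y) ′            ≡⟨ sym (c-′ (x ∧ y)) ⟩
    c (x ∧ y) ′          ≡⟨ cong _′ (∧-′′ x y) ⟩
    (c x ∧ c y) ′        ≡⟨ cong _′ (sym (∨-′ (x ′) (y ′))) ⟩
    c (x ′ ∨ y ′)        ∎

  K-isLattice : IsLattice _≈K_ _∪_ _∩_
  K-isLattice = record
    { isEquivalence = record { refl = refl ; sym = sym ; trans = trans }
    ; ∨-comm     = λ α β → transfer (v₀ ∨ᵗ v₁) (v₁ ∨ᵗ v₀) (α ∷ β ∷ [])
                             (≡⇒~ (DL.∨-comm _ _))
    ; ∨-assoc    = λ α β γ → transfer ((v₀ ∨ᵗ v₁) ∨ᵗ v₂) (v₀ ∨ᵗ (v₁ ∨ᵗ v₂))
                               (α ∷ β ∷ γ ∷ []) (≡⇒~ (DL.∨-assoc _ _ _))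
    ; ∨-cong     = λ p q → cong (c ∘ c) (cong₂ _∨_ p q)
    ; ∧-comm     = λ α β → transfer (v₀ ∧ᵗ v₁) (v₁ ∧ᵗ v₀) (α ∷ β ∷ [])
                             (≡⇒~ (DL.∧-comm _ _))
    ; ∧-assoc    = λ α β γ → transfer ((v₀ ∧ᵗ v₁) ∧ᵗ v₂) (v₀ ∧ᵗ (v₁ ∧ᵗ v₂))
                               (α ∷ β ∷ γ ∷ []) (≡⇒~ (DL.∧-assoc _ _ _))
    ; ∧-cong     = λ p q → cong c (cong₂ _∧_ p q)
    ; absorptive =
        (λ α β → transfer (v₀ ∨ᵗ (v₀ ∧ᵗ v₁)) v₀ (α ∷ β ∷ [])
                   (≡⇒~ (DL.∨-absorbs-∧ _ _)))
      , (λ α β → transfer (v₀ ∧ᵗ (v₀ ∨ᵗ v₁)) v₀ (α ∷ β ∷ [])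
                   (≡⇒~ (DL.∧-absorbs-∨ _ _)))
    }

  K-isDistributiveLattice : IsDistributiveLattice _≈K_ _∪_ _∩_
  K-isDistributiveLattice = record
    { isLattice   = K-isLattice
    ; ∨-distrib-∧ =
        (λ α β γ → transfer (v₀ ∨ᵗ (v₁ ∧ᵗ v₂)) ((v₀ ∨ᵗ v₁) ∧ᵗ (v₀ ∨ᵗ v₂))
                     (α ∷ β ∷ γ ∷ []) (≡⇒~ (DL.∨-distribˡ-∧ _ _ _)))
      , (λ α β γ → transfer ((v₁ ∧ᵗ v₂) ∨ᵗ v₀) ((v₁ ∨ᵗ v₀) ∧ᵗ (v₂ ∨ᵗ v₀))
                     (α ∷ β ∷ γ ∷ []) (≡⇒~ (DL.∨-distribʳ-∧ _ _ _)))
    ; ∧-distrib-∨ =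
        (λ α β γ → transfer (v₀ ∧ᵗ (v₁ ∨ᵗ v₂)) ((v₀ ∧ᵗ v₁) ∨ᵗ (v₀ ∧ᵗ v₂))
                     (α ∷ β ∷ γ ∷ []) (≡⇒~ (DL.∧-distribˡ-∨ _ _ _)))
      , (λ α β γ → transfer ((v₁ ∨ᵗ v₂) ∧ᵗ v₀) ((v₁ ∧ᵗ v₀) ∨ᵗ (v₂ ∧ᵗ v₀))
                     (α ∷ β ∷ γ ∷ []) (≡⇒~ (DL.∧-distribʳ-∨ _ _ _)))
    }

  K-isBoundedDistributiveLattice : IsBoundedDistributiveLattice _≈K_ _∪_ _∩_ 𝟙 𝟘
  K-isBoundedDistributiveLattice = record
    { isDistributiveLattice = K-isDistributiveLattice
    ; ∧-identity =
        (λ α → transfer (⊤ᵗ ∧ᵗ v₀) v₀ (α ∷ []) (≡⇒~ (proj₁ BD.∧-identity _)))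
      , (λ α → transfer (v₀ ∧ᵗ ⊤ᵗ) v₀ (α ∷ []) (≡⇒~ (proj₂ BD.∧-identity _)))
    ; ∨-identity =
        (λ α → transfer (⊥ᵗ ∨ᵗ v₀) v₀ (α ∷ []) (≡⇒~ (proj₁ BD.∨-identity _)))
      , (λ α → transfer (v₀ ∨ᵗ ⊥ᵗ) v₀ (α ∷ []) (≡⇒~ (proj₂ BD.∨-identity _)))
    }

  K-isDeMorganAlgebra : IsDeMorganAlgebra _≈K_ _∩_ _∪_ _* 𝟙 𝟘
  K-isDeMorganAlgebra = record
    { isBoundedDistributiveLattice = K-isBoundedDistributiveLattice
    ; *-cong     = λ p → cong (c ∘ _′) p
    ; 𝟘*≈𝟙       = transfer (⊥ᵗ ′ᵗ) ⊤ᵗ [] (≡⇒~ ⊥′≡⊤)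
    ; 𝟙*≈𝟘       = transfer (⊤ᵗ ′ᵗ) ⊥ᵗ [] (≡⇒~ ⊤′≡⊥)
    ; ∪-deMorgan = λ α β → transfer ((v₀ ∨ᵗ v₁) ′ᵗ) (v₀ ′ᵗ ∧ᵗ v₁ ′ᵗ) (α ∷ β ∷ [])
                             (≡⇒~ (∨-′ _ _))
    ; ∩-deMorgan = λ α β → transfer ((v₀ ∧ᵗ v₁) ′ᵗ) (v₀ ′ᵗ ∨ᵗ v₁ ′ᵗ) (α ∷ β ∷ [])
                             (∧-′-~ _ _)
    ; involutive = λ α → transfer (v₀ ′ᵗ ′ᵗ) v₀ (α ∷ []) (c-~ _)
    }

proposition3p3 : ∀ {a : Level} (𝔸 : SemiDeMorganAlgebra a) →
    IsDeMorganAlgebra (Kernel._≈K_ 𝔸) (Kernel._∩_ 𝔸) (Kernel._∪_ 𝔸)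
      (Kernel._* 𝔸) (Kernel.𝟙 𝔸) (Kernel.𝟘 𝔸)
proposition3p3 𝔸 = KernelIsDeMorgan.K-isDeMorganAlgebra 𝔸
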